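{- Let $v, k, t$ be integers with $1 \leq t < k \leq v$. Then $$C(v+2,k,t) \;\leq\; C(v,k,t) + C(v,k-2,t-1).$$
   Context: For integers $0 \leq t \leq k \leq v$, a $(v,k,t)$ covering design is a family of $k$-element subsets (blocks) of a $v$-element set such that every $t$-element subset is contained in at least one block; $C(v,k,t)$ denotes the minimum number of blocks in such a family. In particular $C(v,k,0)=1$ for $0\le k\le v$. -}

module Defs where

open import Data.Nat using (ℕ; _≤_)
open import Data.Fin.Subset using (Subset; ∣_∣; _⊆_)
open import Data.List using (List; length)
open import Data.List.Relation.Unary.All using (All)
open import Data.List.Relation.Unary.Any using (Any)
open import Data.Product using (_×_)
open import Relation.Binary.PropositionalEquality using (_≡_)

IsCoveringDesign : (v k t : ℕ) → List (Subset v) → Set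
IsCoveringDesign v k t 𝓑 =
  All (λ B → ∣ B ∣ ≡ k) 𝓑 ×
  ((T : Subset v) → ∣ T ∣ ≡ t → Any (λ B → T ⊆ B) 𝓑)

CoveringNumber : (v k t n : ℕ) → Set
CoveringNumber v k t n =
  (Data.Product.∃ λ 𝓑 → IsCoveringDesign v k t 𝓑 × length 𝓑 ≡ n) ×
  ((𝓑 : List (Subset v)) → IsCoveringDesign v k t 𝓑 → n ≤ length 𝓑)

{-# OPTIONS --safe #-}
-- Adjoin two new points x, y to the ground set. Pad every block of a (v,k,t)
-- design with nothing and every block of a (v,k-2,t-1) design with {x, y}.
-- A t-set T avoiding x and y lies in a block of the first kind. Otherwise T
-- meets the ground set in at most t-1 points, which can be enlarged to a
-- (t-1)-set and hence lie in a block B of the second design, so that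
-- T ⊆ B ∪ {x, y}. The same argument with w new points gives
-- C(v+w,k,t) ≤ C(v,k,t) + C(v,k-w,t-1).
module Submission where

open import Defs
open import Data.Nat using (ℕ; zero; suc; _≤_; _<_; _+_; _∸_; s≤s; z≤n; _≤?_)
open import Data.Nat.Properties
  using (≤-trans; ≤-reflexive; ≤-antisym; ≰⇒>; <⇒≤; n≤1+n; m+n≤o⇒m≤o;
         +-suc; +-comm; +-identityʳ; suc-injective)
open import Data.Fin.Subset using (Subset; ∣_∣; _⊆_; ⊥; ⊤; inside; outside)
open import Data.Fin.Subset.Properties
  using (⊆-refl; ⊆-trans; ⊆-reflexive; ⊆⊤; s⊆s; out⊆; in⊆in; drop-∷-⊆; ∣⊥∣≡0; ∣⊤∣≡n)
open import Data.Vec using ([]; _∷_; _++_; splitAt; here)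
open import Data.List using (List; length; map) renaming (_++_ to _++ₗ_)
open import Data.List.Properties using (length-++; length-map)
open import Data.List.Relation.Unary.All using (All)
import Data.List.Relation.Unary.All as All
import Data.List.Relation.Unary.All.Properties as All
open import Data.List.Relation.Unary.Any using (Any)
import Data.List.Relation.Unary.Any as Any
import Data.List.Relation.Unary.Any.Properties as Any
open import Data.Product using (_×_; _,_; ∃-syntax)
open import Relation.Nullary using (yes; no; contradiction)
open import Relation.Binary.PropositionalEquality using (_≡_; refl; sym; trans; cong; cong₂; subst)

∣p++q∣≡∣p∣+∣q∣ : ∀ {m n} (p : Subset m) (q : Subset n) → ∣ p ++ q ∣ ≡ ∣ p ∣ + ∣ q ∣
∣p++q∣≡∣p∣+∣q∣ []            q = refl
∣p++q∣≡∣p∣+∣q∣ (outside ∷ p) q = ∣p++q∣≡∣p∣+∣q∣ p q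
∣p++q∣≡∣p∣+∣q∣ (inside  ∷ p) q = cong suc (∣p++q∣≡∣p∣+∣q∣ p q)

++-mono-⊆ : ∀ {m n} {p q : Subset m} {r s : Subset n} → p ⊆ q → r ⊆ s → p ++ r ⊆ q ++ s
++-mono-⊆ {p = []}          {[]}          p⊆q r⊆s = r⊆s
++-mono-⊆ {p = outside ∷ p} {_ ∷ q}       p⊆q r⊆s = out⊆ (++-mono-⊆ (drop-∷-⊆ p⊆q) r⊆s)
++-mono-⊆ {p = inside  ∷ p} {inside ∷ q}  p⊆q r⊆s = in⊆in (++-mono-⊆ (drop-∷-⊆ p⊆q) r⊆s)
++-mono-⊆ {p = inside  ∷ p} {outside ∷ q} p⊆q r⊆s = contradiction (p⊆q here) λ ()

∣p∣≡0⇒p≡⊥ : ∀ {n} (p : Subset n) → ∣ p ∣ ≡ 0 → p ≡ ⊥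
∣p∣≡0⇒p≡⊥ []            _     = refl
∣p∣≡0⇒p≡⊥ (outside ∷ p) ∣p∣≡0 = cong (outside ∷_) (∣p∣≡0⇒p≡⊥ p ∣p∣≡0)

superset-of-size : ∀ {n m} (p : Subset n) → ∣ p ∣ ≤ m → m ≤ n → ∃[ q ] p ⊆ q × ∣ q ∣ ≡ m
superset-of-size []            _           z≤n       = [] , ⊆-refl , refl
superset-of-size (inside ∷ p)  (s≤s ∣p∣≤m) (s≤s m≤n) =
  let q , p⊆q , ∣q∣≡m = superset-of-size p ∣p∣≤m m≤n in
  inside ∷ q , in⊆in p⊆q , cong suc ∣q∣≡m
superset-of-size {suc n} {m} (outside ∷ p) ∣p∣≤m m≤1+n with m ≤? n
... | yes m≤n =
  let q , p⊆q , ∣q∣≡m = superset-of-size p ∣p∣≤m m≤n in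
  outside ∷ q , s⊆s p⊆q , ∣q∣≡m
... | no  m≰n = ⊤ , ⊆⊤ , trans (∣⊤∣≡n (suc n)) (≤-antisym (≰⇒> m≰n) m≤1+n)

Covers : ∀ {v} → ℕ → List (Subset v) → Set
Covers {v} t 𝓑 = (T : Subset v) → ∣ T ∣ ≡ t → Any (T ⊆_) 𝓑

covers-≤ : ∀ {v t} {𝓑 : List (Subset v)} → t ≤ v → Covers t 𝓑 →
           (T : Subset v) → ∣ T ∣ ≤ t → Any (T ⊆_) 𝓑
covers-≤ t≤v covers T ∣T∣≤t =
  let Q , T⊆Q , ∣Q∣≡t = superset-of-size T ∣T∣≤t t≤v in
  Any.map (⊆-trans T⊆Q) (covers Q ∣Q∣≡t)

augment : ∀ {v} w → List (Subset v) → List (Subset v) → List (Subset (v + w))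
augment w 𝓑₁ 𝓑₂ = map (_++ ⊥) 𝓑₁ ++ₗ map (_++ ⊤) 𝓑₂

length-augment : ∀ {v} w (𝓑₁ 𝓑₂ : List (Subset v)) →
                 length (augment w 𝓑₁ 𝓑₂) ≡ length 𝓑₁ + length 𝓑₂
length-augment w 𝓑₁ 𝓑₂ = trans (length-++ (map (_++ ⊥) 𝓑₁))
  (cong₂ _+_ (length-map (_++ ⊥) 𝓑₁) (length-map (_++ ⊤) 𝓑₂))

augment-blockSizes : ∀ {v} w j {𝓑₁ 𝓑₂ : List (Subset v)} →
                     All (λ B → ∣ B ∣ ≡ w + j) 𝓑₁ → All (λ B → ∣ B ∣ ≡ j) 𝓑₂ →
                     All (λ B → ∣ B ∣ ≡ w + j) (augment w 𝓑₁ 𝓑₂)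
augment-blockSizes w j sizes₁ sizes₂ =
  All.++⁺ (All.map⁺ (All.map (λ {B} → padded-⊥ B) sizes₁)) (All.map⁺ (All.map (λ {B} → padded-⊤ B) sizes₂))
  where
  padded-⊥ : ∀ B → ∣ B ∣ ≡ w + j → ∣ B ++ ⊥ {w} ∣ ≡ w + j
  padded-⊥ B ∣B∣≡w+j = trans (∣p++q∣≡∣p∣+∣q∣ B ⊥)
    (trans (cong (∣ B ∣ +_) (∣⊥∣≡0 w)) (trans (+-identityʳ ∣ B ∣) ∣B∣≡w+j))
  padded-⊤ : ∀ B → ∣ B ∣ ≡ j → ∣ B ++ ⊤ {w} ∣ ≡ w + j
  padded-⊤ B ∣B∣≡j = trans (∣p++q∣≡∣p∣+∣q∣ B ⊤)
    (trans (cong₂ _+_ ∣B∣≡j (∣⊤∣≡n w)) (+-comm j w))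

augment-covers : ∀ {v} w s {𝓑₁ 𝓑₂ : List (Subset v)} → s ≤ v →
                 Covers (suc s) 𝓑₁ → Covers s 𝓑₂ → Covers (suc s) (augment w 𝓑₁ 𝓑₂)
augment-covers {v} w s {𝓑₁} {𝓑₂} s≤v covers₁ covers₂ T ∣T∣≡1+s with splitAt v T
... | P , R , refl = cover P R (trans (sym (∣p++q∣≡∣p∣+∣q∣ P R)) ∣T∣≡1+s)
  where
  via𝓑₁ : ∀ P R → ∣ P ∣ ≡ suc s → R ⊆ ⊥ → Any (P ++ R ⊆_) (augment w 𝓑₁ 𝓑₂)
  via𝓑₁ P R ∣P∣≡1+s R⊆⊥ =
    Any.++⁺ˡ (Any.map⁺ (Any.map padded (covers₁ P ∣P∣≡1+s)))
    where
    padded : ∀ {B} → P ⊆ B → P ++ R ⊆ B ++ ⊥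
    padded P⊆B = ++-mono-⊆ P⊆B R⊆⊥

  via𝓑₂ : ∀ P R → ∣ P ∣ ≤ s → Any (P ++ R ⊆_) (augment w 𝓑₁ 𝓑₂)
  via𝓑₂ P R ∣P∣≤s = Any.++⁺ʳ (map (_++ ⊥) 𝓑₁)
    (Any.map⁺ (Any.map padded (covers-≤ s≤v covers₂ P ∣P∣≤s)))
    where
    padded : ∀ {B} → P ⊆ B → P ++ R ⊆ B ++ ⊤
    padded P⊆B = ++-mono-⊆ P⊆B ⊆⊤

  cover : ∀ P R → ∣ P ∣ + ∣ R ∣ ≡ suc s → Any (P ++ R ⊆_) (augment w 𝓑₁ 𝓑₂)
  cover P R ∣P∣+∣R∣≡1+s with ∣ R ∣ in ∣R∣≡n
  ... | zero  = via𝓑₁ P R (trans (sym (+-identityʳ ∣ P ∣)) ∣P∣+∣R∣≡1+s)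
                          (⊆-reflexive (∣p∣≡0⇒p≡⊥ R ∣R∣≡n))
  ... | suc n = via𝓑₂ P R (m+n≤o⇒m≤o ∣ P ∣ (≤-reflexive ∣P∣+n≡s))
    where
    ∣P∣+n≡s : ∣ P ∣ + n ≡ s
    ∣P∣+n≡s = suc-injective (trans (sym (+-suc ∣ P ∣ n)) ∣P∣+∣R∣≡1+s)

augment-isCoveringDesign : ∀ {v} w j s {𝓑₁ 𝓑₂ : List (Subset v)} → s ≤ v →
                           IsCoveringDesign v (w + j) (suc s) 𝓑₁ →
                           IsCoveringDesign v j s 𝓑₂ →
                           IsCoveringDesign (v + w) (w + j) (suc s) (augment w 𝓑₁ 𝓑₂)
augment-isCoveringDesign w j s s≤v (sizes₁ , covers₁) (sizes₂ , covers₂) =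
  augment-blockSizes w j sizes₁ sizes₂ , augment-covers w s s≤v covers₁ covers₂

mainTheorem2 : (v k t : ℕ) → 1 ≤ t → t < k → k ≤ v →
    (a b c : ℕ) →
    CoveringNumber (v + 2) k t a →
    CoveringNumber v k t b →
    CoveringNumber v (k ∸ 2) (t ∸ 1) c →
    a ≤ b + c
mainTheorem2 v (suc (suc j)) (suc s) (s≤s z≤n) t<k@(s≤s (s≤s _)) k≤v a b c
  (_ , minimal) ((𝓑₁ , design₁ , refl) , _) ((𝓑₂ , design₂ , refl) , _) =
  subst (a ≤_) (length-augment 2 𝓑₁ 𝓑₂)
    (minimal (augment 2 𝓑₁ 𝓑₂) (augment-isCoveringDesign 2 j s s≤v design₁ design₂))
  where
  s≤v : s ≤ v
  s≤v = ≤-trans (n≤1+n s) (≤-trans (<⇒≤ t<k) k≤v)
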